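{- Let $AP$ be a set of atomic propositions. For every $u\in(2^{AP})^\omega$ and every $\mathrm{LTL}^{\leq}$ formula $\phi$, $\overline{[\![\neg\phi]\!]}(u)=\max(0,[\![\phi]\!](u)-1)$ (with $\infty-1=\infty$).
   Context: Notation: for $u \in (2^{AP})^{\omega}$, $u_i$ is its $i$-th letter and $u^i$ its suffix starting at $u_i$. $\mathrm{LTL}^{\leq}$: grammar $\phi ::= a \mid \neg a \mid \phi\vee\phi \mid \phi\wedge\phi \mid \phi\mathbf{U}\phi \mid \phi\mathbf{R}\phi \mid \mathbf{X}\phi \mid \phi\mathbf{U}^{\leq}\phi$ ($a\in AP$), with relation $(u,n)\models_{\inf}$: $(u,n)\models a$ iff $a\in u_0$; $(u,n)\models\neg a$ iff $a\notin u_0$; $\vee,\wedge$ as usual; $(u,n)\models\mathbf{X}\phi_1$ iff $(u^1,n)\models\phi_1$; $\phi_1\mathbf{U}\phi_2$: some $i$ with $(u^i,n)\models\phi_2$ and $(u^j,n)\models\phi_1$ for all $j<i$; $\phi_1\mathbf{R}\phi_2$: for all $i$, $(u^i,n)\models\phi_2$ or some $j<i$ has $(u^j,n)\models\phi_1$; $\phi_1\mathbf{U}^{\leq}\phi_2$: some $i$ with $(u^i,n)\models\phi_2$ and $|\{j<i\mid (u^j,n)\not\models\phi_1\}|\leq n$. Value $[\![\phi]\!](u)=\inf\{n\mid (u,n)\models_{\inf}\phi\}$, $\inf\emptyset=\infty$. $\mathrm{LTL}^{>}$: grammar $\phi ::= a \mid \neg a \mid \phi\vee\phi \mid \phi\wedge\phi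 \mid \phi\mathbf{U}\phi \mid \phi\mathbf{R}\phi \mid \mathbf{X}\phi \mid \phi\mathbf{R}^{>}\phi$, with relation $(u,n)\models_{\sup}$ defined by the same clauses for the common operators, and $(u,n)\models_{\sup}\phi_1\mathbf{R}^{>}\phi_2$ iff for every $i\in\mathbb{N}$, either $(u^i,n)\models_{\sup}\phi_2$ or $|\{j<i\mid (u^j,n)\models_{\sup}\phi_1\}|>n$. Value $\overline{[\![\phi]\!]}(u)=\sup\{n\mid (u,n)\models_{\sup}\phi\}$, with $\sup\emptyset=0$. Negation: for $\phi$ in $\mathrm{LTL}^{\leq}$ (resp. $\mathrm{LTL}^{>}$), $\neg\phi$ is the $\mathrm{LTL}^{>}$ (resp. $\mathrm{LTL}^{\leq}$) formula obtained by pushing negation to the leaves: $\neg(a)=\neg a$, $\neg(\neg a)=a$, $\neg(\phi_1\vee\phi_2)=\neg\phi_1\wedge\neg\phi_2$ and dually, $\neg(\phi_1\mathbf{U}\phi_2)=\neg\phi_1\mathbf{R}\neg\phi_2$ and dually, $\neg(\phi_1\mathbf{U}^{\leq}\phi_2)=\neg\phi_1\mathbf{R}^{>}\neg\phi_2$ and dually, $\neg\mathbf{X}\phi_1=\mathbf{X}\neg\phi_1$. -}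

module Defs where

open import Data.Nat using (ℕ; zero; suc; _+_; _≤_; _<_; pred)
open import Data.Bool using (Bool; true; false)
open import Data.List using (List; length)
open import Data.List.Membership.Propositional using (_∈_)
open import Data.List.Relation.Unary.All using (All)
open import Data.List.Relation.Unary.Unique.Propositional using (Unique)
open import Data.Maybe using (Maybe; just; nothing)
open import Data.Product using (Σ; _×_; ∃)
open import Data.Sum using (_⊎_)
open import Data.Empty using (⊥)
open import Relation.Nullary using (¬_)
open import Relation.Binary.PropositionalEquality using (_≡_)

-- Infinite words over 2^AP: a letter is a subset of AP (characteristic function)
Word : Set → Set
Word AP = ℕ → (AP → Bool)

suffix : {AP : Set} → Word AP → ℕ → Word AP
suffix u i k = u (i + k)

data LTL≤ (AP : Set) : Set where
  atom    : AP → LTL≤ AP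
  natom   : AP → LTL≤ AP
  _∨_     : LTL≤ AP → LTL≤ AP → LTL≤ AP
  _∧_     : LTL≤ AP → LTL≤ AP → LTL≤ AP
  _U_     : LTL≤ AP → LTL≤ AP → LTL≤ AP
  _R_     : LTL≤ AP → LTL≤ AP → LTL≤ AP
  X       : LTL≤ AP → LTL≤ AP
  _U≤_    : LTL≤ AP → LTL≤ AP → LTL≤ AP

data LTL> (AP : Set) : Set where
  atom    : AP → LTL> AP
  natom   : AP → LTL> AP
  _∨_     : LTL> AP → LTL> AP → LTL> AP
  _∧_     : LTL> AP → LTL> AP → LTL> AP
  _U_     : LTL> AP → LTL> AP → LTL> AP
  _R_     : LTL> AP → LTL> AP → LTL> AP
  X       : LTL> AP → LTL> AP
  _R>_    : LTL> AP → LTL> AP → LTL> AP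

-- negation pushed to the leaves
neg≤ : {AP : Set} → LTL≤ AP → LTL> AP
neg≤ (atom a)   = natom a
neg≤ (natom a)  = atom a
neg≤ (φ ∨ ψ)    = neg≤ φ ∧ neg≤ ψ
neg≤ (φ ∧ ψ)    = neg≤ φ ∨ neg≤ ψ
neg≤ (φ U ψ)    = neg≤ φ R neg≤ ψ
neg≤ (φ R ψ)    = neg≤ φ U neg≤ ψ
neg≤ (X φ)      = X (neg≤ φ)
neg≤ (φ U≤ ψ)   = neg≤ φ R> neg≤ ψ

-- |{ j < i | ¬ P j }| ≤ n : the set is covered by a list of length ≤ n
FailuresAtMost : (ℕ → Set) → ℕ → ℕ → Set
FailuresAtMost P i n =
  Σ (List ℕ) λ l → (length l ≤ n) × (∀ j → j < i → ¬ P j → j ∈ l)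

-- |{ j < i | P j }| > n : n+1 distinct elements of the set
MoreThan : (ℕ → Set) → ℕ → ℕ → Set
MoreThan P i n =
  Σ (List ℕ) λ l → (length l ≡ suc n) × Unique l × All (λ j → j < i × P j) l

Sat≤ : {AP : Set} → Word AP → ℕ → LTL≤ AP → Set
Sat≤ u n (atom a)  = u 0 a ≡ true
Sat≤ u n (natom a) = u 0 a ≡ false
Sat≤ u n (φ ∨ ψ)   = Sat≤ u n φ ⊎ Sat≤ u n ψ
Sat≤ u n (φ ∧ ψ)   = Sat≤ u n φ × Sat≤ u n ψ
Sat≤ u n (φ U ψ)   =
  ∃ λ i → Sat≤ (suffix u i) n ψ × (∀ j → j < i → Sat≤ (suffix u j) n φ)
Sat≤ u n (φ R ψ)   =
  ∀ i → Sat≤ (suffix u i) n ψ ⊎ (∃ λ j → j < i × Sat≤ (suffix u j) n φ)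
Sat≤ u n (X φ)     = Sat≤ (suffix u 1) n φ
Sat≤ u n (φ U≤ ψ)  =
  ∃ λ i → Sat≤ (suffix u i) n ψ × FailuresAtMost (λ j → Sat≤ (suffix u j) n φ) i n

Sat> : {AP : Set} → Word AP → ℕ → LTL> AP → Set
Sat> u n (atom a)  = u 0 a ≡ true
Sat> u n (natom a) = u 0 a ≡ false
Sat> u n (φ ∨ ψ)   = Sat> u n φ ⊎ Sat> u n ψ
Sat> u n (φ ∧ ψ)   = Sat> u n φ × Sat> u n ψ
Sat> u n (φ U ψ)   =
  ∃ λ i → Sat> (suffix u i) n ψ × (∀ j → j < i → Sat> (suffix u j) n φ)
Sat> u n (φ R ψ)   =
  ∀ i → Sat> (suffix u i) n ψ ⊎ (∃ λ j → j < i × Sat> (suffix u j) n φ)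
Sat> u n (X φ)     = Sat> (suffix u 1) n φ
Sat> u n (φ R> ψ)  =
  ∀ i → Sat> (suffix u i) n ψ ⊎ MoreThan (λ j → Sat> (suffix u j) n φ) i n

-- ℕ ∪ {∞}: nothing = ∞
ℕ∞ : Set
ℕ∞ = Maybe ℕ

-- v = inf S  (inf ∅ = ∞)
IsInf : ℕ∞ → (ℕ → Set) → Set
IsInf nothing  S = ∀ n → ¬ S n
IsInf (just m) S = S m × (∀ n → S n → m ≤ n)

-- v = sup S  (sup ∅ = 0)
IsSup : ℕ∞ → (ℕ → Set) → Set
IsSup nothing  S = ∀ k → ¬ (∀ n → S n → n ≤ k)
IsSup (just m) S = (∀ n → S n → n ≤ m) × (∀ k → (∀ n → S n → n ≤ k) → m ≤ k)

Value≤ : {AP : Set} → LTL≤ AP → Word AP → ℕ∞ → Set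
Value≤ φ u v = IsInf v (λ n → Sat≤ u n φ)

Value> : {AP : Set} → LTL> AP → Word AP → ℕ∞ → Set
Value> φ u v = IsSup v (λ n → Sat> u n φ)

pred∞ : ℕ∞ → ℕ∞
pred∞ nothing  = nothing
pred∞ (just m) = just (pred m)

-- Satisfaction of an LTL≤ formula is upward closed in the bound n, and (u , n) ⊨sup ¬φ
-- holds exactly when (u , n) ⊨inf φ fails. So the sets of bounds of φ and of ¬φ are
-- complementary, the first an up-set {n ≥ m} with m = [[φ]](u); the second is then {n < m},
-- whose supremum is m − 1. The only nontrivial case of the duality is U≤ against R>:
-- n+1 distinct failures cannot be covered by a list of length n (pigeonhole), and
-- conversely, classically, listing all failures below i either yields at most n of them or
-- n+1 distinct ones.
module Submission where

open import Defs
open import Level using (0ℓ)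
open import Axiom.ExcludedMiddle using (ExcludedMiddle)
open import Axiom.DoubleNegationElimination using (em⇒dne)
open import Data.Bool.Properties using (not-¬; ¬-not)
open import Data.Nat using (ℕ; suc; _≤_; _<_; z≤n; s≤s; pred; _≤?_)
open import Data.Nat.Properties
  using (≤-trans; ≰⇒>; <⇒≱; n<1+n; <⇒≤pred; pred-mono-≤; m≤n⇒m⊓n≡m; module ≤-Reasoning)
open import Data.List using (List; []; _∷_; length; take; filter; upTo)
open import Data.List.Properties using (length-take; length-removeAt′)
open import Data.List.Membership.Propositional using (_∈_)
open import Data.List.Membership.Propositional.Properties
  using (∈-filter⁺; ∈-filter⁻; ∈-upTo⁺; ∈-upTo⁻)
open import Data.List.Relation.Binary.Subset.Propositional using (_⊆_)
open import Data.List.Relation.Unary.Any using (here; there; index; _─_)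
open import Data.List.Relation.Unary.All as All using (All)
import Data.List.Relation.Unary.All.Properties as All
open import Data.List.Relation.Unary.AllPairs using (_∷_)
open import Data.List.Relation.Unary.Unique.Propositional using (Unique)
import Data.List.Relation.Unary.Unique.Propositional.Properties as Unique
open import Data.Maybe using (just; nothing)
open import Data.Product using (_×_; _,_; ∃)
open import Data.Sum using (_⊎_; inj₁; inj₂)
open import Data.Empty using (⊥-elim)
open import Relation.Nullary using (¬_; Dec; yes; no)
open import Relation.Nullary.Decidable using (¬?)
open import Relation.Binary.PropositionalEquality using (_≡_; _≢_; refl; sym; trans; subst)

∈-─ : ∀ {A : Set} {x y : A} {xs : List A} (x∈xs : x ∈ xs) → y ∈ xs → y ≢ x → y ∈ (xs ─ x∈xs)
∈-─ (here refl)  (here refl)  y≢x = ⊥-elim (y≢x refl)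
∈-─ (here _)     (there y∈xs) _   = y∈xs
∈-─ (there _)    (here y≡z)   _   = here y≡z
∈-─ (there x∈xs) (there y∈xs) y≢x = there (∈-─ x∈xs y∈xs y≢x)

Unique⇒length-mono-≤ : ∀ {A : Set} {xs ys : List A} → Unique xs → xs ⊆ ys → length xs ≤ length ys
Unique⇒length-mono-≤ {xs = []} _ _ = z≤n
Unique⇒length-mono-≤ {xs = x ∷ xs} {ys} (x∉xs ∷ xs!) xs⊆ys = begin
  suc (length xs)          ≤⟨ s≤s (Unique⇒length-mono-≤ xs! xs⊆ys─x) ⟩
  suc (length (ys ─ x∈ys)) ≡⟨ sym (length-removeAt′ ys (index x∈ys)) ⟩
  length ys                ∎
  where
  open ≤-Reasoning
  x∈ys : x ∈ ys
  x∈ys = xs⊆ys (here refl)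
  xs⊆ys─x : xs ⊆ (ys ─ x∈ys)
  xs⊆ys─x y∈xs = ∈-─ x∈ys (xs⊆ys (there y∈xs)) λ y≡x → All.lookup x∉xs y∈xs (sym y≡x)

module _ {P Q : ℕ → Set} {i : ℕ} where

  FailuresAtMost-mono : ∀ {m n} → (∀ j → P j → Q j) → m ≤ n →
                        FailuresAtMost P i m → FailuresAtMost Q i n
  FailuresAtMost-mono P⇒Q m≤n (l , ∣l∣≤m , covers) =
    l , ≤-trans ∣l∣≤m m≤n , λ j j<i ¬Qj → covers j j<i λ Pj → ¬Qj (P⇒Q j Pj)

  MoreThan-map : ∀ {n} → (∀ j → P j → Q j) → MoreThan P i n → MoreThan Q i n
  MoreThan-map P⇒Q (l , ∣l∣≡1+n , l! , inside) =
    l , ∣l∣≡1+n , l! , All.map (λ (j<i , Pj) → j<i , P⇒Q _ Pj) inside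

  FailuresAtMost⇒¬MoreThan : ∀ {n} → (∀ j → Q j → ¬ P j) →
                             FailuresAtMost P i n → ¬ MoreThan Q i n
  FailuresAtMost⇒¬MoreThan Q⇒¬P (l , ∣l∣≤n , covers) (l′ , ∣l′∣≡1+n , l′! , inside) =
    <⇒≱ (s≤s ∣l∣≤n) (subst (_≤ length l) ∣l′∣≡1+n (Unique⇒length-mono-≤ l′! l′⊆l))
    where
    l′⊆l : l′ ⊆ l
    l′⊆l j∈l′ with All.lookup inside j∈l′
    ... | j<i , Qj = covers _ j<i (Q⇒¬P _ Qj)

FailuresAtMost⊎MoreThan : {P : ℕ → Set} → (∀ j → Dec (P j)) → ∀ i n →
                          FailuresAtMost P i n ⊎ MoreThan (λ j → ¬ P j) i n
FailuresAtMost⊎MoreThan {P} P? i n = split (length failures ≤? n)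
  where
  ¬P? : ∀ j → Dec (¬ P j)
  ¬P? j = ¬? (P? j)

  failures : List ℕ
  failures = filter ¬P? (upTo i)

  failures! : Unique failures
  failures! = Unique.filter⁺ ¬P? (Unique.upTo⁺ i)

  failures-below-i : All (λ j → j < i × ¬ P j) failures
  failures-below-i = All.tabulate λ j∈ →
    let j∈upTo , ¬Pj = ∈-filter⁻ ¬P? j∈ in ∈-upTo⁻ j∈upTo , ¬Pj

  split : Dec (length failures ≤ n) → FailuresAtMost P i n ⊎ MoreThan (λ j → ¬ P j) i n
  split (yes ∣failures∣≤n) =
    inj₁ (failures , ∣failures∣≤n , λ j j<i ¬Pj → ∈-filter⁺ ¬P? (∈-upTo⁺ j<i) ¬Pj)
  split (no ∣failures∣≰n) =
    inj₂ (take (suc n) failures , ∣take∣≡1+n , Unique.take⁺ (suc n) failures!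
         , All.take⁺ (suc n) failures-below-i)
    where
    ∣take∣≡1+n : length (take (suc n) failures) ≡ suc n
    ∣take∣≡1+n = trans (length-take (suc n) failures) (m≤n⇒m⊓n≡m (≰⇒> ∣failures∣≰n))

Sat≤-mono : ∀ {AP : Set} (φ : LTL≤ AP) (u : Word AP) {m n} → m ≤ n → Sat≤ u m φ → Sat≤ u n φ
Sat≤-mono (atom a)  u m≤n s = s
Sat≤-mono (natom a) u m≤n s = s
Sat≤-mono (φ ∨ ψ)   u m≤n (inj₁ s) = inj₁ (Sat≤-mono φ u m≤n s)
Sat≤-mono (φ ∨ ψ)   u m≤n (inj₂ s) = inj₂ (Sat≤-mono ψ u m≤n s)
Sat≤-mono (φ ∧ ψ)   u m≤n (s , t)  = Sat≤-mono φ u m≤n s , Sat≤-mono ψ u m≤n t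
Sat≤-mono (φ U ψ)   u m≤n (i , sψ , sφ) =
  i , Sat≤-mono ψ _ m≤n sψ , λ j j<i → Sat≤-mono φ _ m≤n (sφ j j<i)
Sat≤-mono (φ R ψ)   u m≤n s i with s i
... | inj₁ sψ             = inj₁ (Sat≤-mono ψ _ m≤n sψ)
... | inj₂ (j , j<i , sφ) = inj₂ (j , j<i , Sat≤-mono φ _ m≤n sφ)
Sat≤-mono (X φ)     u m≤n s = Sat≤-mono φ _ m≤n s
Sat≤-mono (φ U≤ ψ)  u m≤n (i , sψ , few) =
  i , Sat≤-mono ψ _ m≤n sψ , FailuresAtMost-mono (λ j → Sat≤-mono φ _ m≤n) m≤n few

neg≤-sound : ∀ {AP : Set} (φ : LTL≤ AP) (u : Word AP) n → Sat> u n (neg≤ φ) → ¬ Sat≤ u n φ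
neg≤-sound (atom a)  u n s> s≤ = not-¬ s> s≤
neg≤-sound (natom a) u n s> s≤ = not-¬ s≤ s>
neg≤-sound (φ ∨ ψ)   u n (s>φ , s>ψ) (inj₁ s≤φ) = neg≤-sound φ u n s>φ s≤φ
neg≤-sound (φ ∨ ψ)   u n (s>φ , s>ψ) (inj₂ s≤ψ) = neg≤-sound ψ u n s>ψ s≤ψ
neg≤-sound (φ ∧ ψ)   u n (inj₁ s>φ) (s≤φ , s≤ψ) = neg≤-sound φ u n s>φ s≤φ
neg≤-sound (φ ∧ ψ)   u n (inj₂ s>ψ) (s≤φ , s≤ψ) = neg≤-sound ψ u n s>ψ s≤ψ
neg≤-sound (φ U ψ)   u n s> (i , s≤ψ , s≤φ) with s> i
... | inj₁ s>ψ             = neg≤-sound ψ _ n s>ψ s≤ψ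
... | inj₂ (j , j<i , s>φ) = neg≤-sound φ _ n s>φ (s≤φ j j<i)
neg≤-sound (φ R ψ)   u n (i , s>ψ , s>φ) s≤ with s≤ i
... | inj₁ s≤ψ             = neg≤-sound ψ _ n s>ψ s≤ψ
... | inj₂ (j , j<i , s≤φ) = neg≤-sound φ _ n (s>φ j j<i) s≤φ
neg≤-sound (X φ)     u n s> s≤ = neg≤-sound φ _ n s> s≤
neg≤-sound (φ U≤ ψ)  u n s> (i , s≤ψ , few) with s> i
... | inj₁ s>ψ  = neg≤-sound ψ _ n s>ψ s≤ψ
... | inj₂ many = FailuresAtMost⇒¬MoreThan (λ j → neg≤-sound φ _ n) few many

module Classical (em : ExcludedMiddle 0ℓ) where

  private
    dne : {A : Set} → ¬ ¬ A → A
    dne = em⇒dne em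

    ¬×⇒¬⊎¬ : {A B : Set} → ¬ (A × B) → ¬ A ⊎ ¬ B
    ¬×⇒¬⊎¬ {A} ¬a×b with em {A}
    ... | yes a = inj₂ λ b → ¬a×b (a , b)
    ... | no ¬a = inj₁ ¬a

    ¬∀⇒∃¬ : {A : Set} {B : A → Set} → ¬ (∀ x → B x) → ∃ λ x → ¬ B x
    ¬∀⇒∃¬ ¬∀ = dne λ ¬∃ → ¬∀ λ x → dne λ ¬Bx → ¬∃ (x , ¬Bx)

    ¬→⇒×¬ : {A B : Set} → ¬ (A → B) → A × ¬ B
    ¬→⇒×¬ ¬a→b = dne (λ ¬a → ¬a→b λ a → ⊥-elim (¬a a)) , λ b → ¬a→b λ _ → b

  neg≤-complete : ∀ {AP : Set} (φ : LTL≤ AP) (u : Word AP) n → ¬ Sat≤ u n φ → Sat> u n (neg≤ φ)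
  neg≤-complete (atom a)  u n ¬s = ¬-not ¬s
  neg≤-complete (natom a) u n ¬s = ¬-not ¬s
  neg≤-complete (φ ∨ ψ)   u n ¬s =
    neg≤-complete φ u n (λ s → ¬s (inj₁ s)) , neg≤-complete ψ u n (λ s → ¬s (inj₂ s))
  neg≤-complete (φ ∧ ψ)   u n ¬s with ¬×⇒¬⊎¬ ¬s
  ... | inj₁ ¬sφ = inj₁ (neg≤-complete φ u n ¬sφ)
  ... | inj₂ ¬sψ = inj₂ (neg≤-complete ψ u n ¬sψ)
  neg≤-complete (φ U ψ)   u n ¬s i with ¬×⇒¬⊎¬ (λ s → ¬s (i , s))
  ... | inj₁ ¬sψ = inj₁ (neg≤-complete ψ _ n ¬sψ)
  ... | inj₂ ¬∀sφ with ¬∀⇒∃¬ ¬∀sφ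
  ...   | j , ¬[j<i→sφ] with ¬→⇒×¬ ¬[j<i→sφ]
  ...     | j<i , ¬sφ = inj₂ (j , j<i , neg≤-complete φ _ n ¬sφ)
  neg≤-complete (φ R ψ)   u n ¬s with ¬∀⇒∃¬ ¬s
  ... | i , ¬s[i] =
    i , neg≤-complete ψ _ n (λ s → ¬s[i] (inj₁ s))
      , λ j j<i → neg≤-complete φ _ n λ s → ¬s[i] (inj₂ (j , j<i , s))
  neg≤-complete (X φ)     u n ¬s = neg≤-complete φ _ n ¬s
  neg≤-complete (φ U≤ ψ)  u n ¬s i with ¬×⇒¬⊎¬ (λ s → ¬s (i , s))
  ... | inj₁ ¬sψ = inj₁ (neg≤-complete ψ _ n ¬sψ)
  ... | inj₂ ¬few with FailuresAtMost⊎MoreThan (λ j → em) i n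
  ...   | inj₁ few  = ⊥-elim (¬few few)
  ...   | inj₂ many = inj₂ (MoreThan-map (λ j → neg≤-complete φ _ n) many)

IsInf⇒IsSup-complement : {P Q : ℕ → Set} → (∀ {m n} → m ≤ n → P m → P n) →
                         (∀ n → Q n → ¬ P n) → (∀ n → ¬ P n → Q n) →
                         ∀ v → IsInf v P → IsSup (pred∞ v) Q
IsInf⇒IsSup-complement up Q⇒¬P ¬P⇒Q nothing ¬P k Q≤k =
  <⇒≱ (n<1+n k) (Q≤k (suc k) (¬P⇒Q (suc k) (¬P (suc k))))
IsInf⇒IsSup-complement {Q = Q} up Q⇒¬P ¬P⇒Q (just m) (Pm , m-least) = Q≤pred-m , pred-m-least
  where
  Q≤pred-m : ∀ n → Q n → n ≤ pred m
  Q≤pred-m n Qn with m ≤? n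
  ... | yes m≤n = ⊥-elim (Q⇒¬P n Qn (up m≤n Pm))
  ... | no m≰n  = <⇒≤pred (≰⇒> m≰n)

  pred-m-least : ∀ k → (∀ n → Q n → n ≤ k) → pred m ≤ k
  pred-m-least k Q≤k with m ≤? suc k
  ... | yes m≤1+k = pred-mono-≤ m≤1+k
  ... | no m≰1+k  =
    ⊥-elim (<⇒≱ (n<1+n k) (Q≤k (suc k) (¬P⇒Q (suc k) λ P[1+k] → m≰1+k (m-least (suc k) P[1+k]))))

proposition2 : ExcludedMiddle 0ℓ → (AP : Set) (u : Word AP) (φ : LTL≤ AP) (v : ℕ∞) →
    Value≤ φ u v → Value> (neg≤ φ) u (pred∞ v)
proposition2 em AP u φ =
  IsInf⇒IsSup-complement (Sat≤-mono φ u) (neg≤-sound φ u) (Classical.neg≤-complete em φ u)
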